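{- There is an absolute constant $c>0$ such that for every integer $n\geq 6$ there is a red/blue coloring $\phi$ of the pairs of $X=\{0,1,\ldots,\lfloor 2^{cn}\rfloor-1\}$ with the following two properties: (1) there are no two disjoint $n$-element sets $A,B\subset X$ such that $\phi(a,b)=$ red for all $a\in A,b\in B$, or $\phi(a,b)=$ blue for all $a\in A,b\in B$; (2) there is no $n$-element set $A\subset X$ such that every triple $a_i<a_j<a_k$ of elements of $A$ avoids the pattern $\phi(a_i,a_j)=\phi(a_j,a_k)=$ blue and $\phi(a_i,a_k)=$ red (i.e., every $n$-element subset of $X$ contains a triple $a_i<a_j<a_k$ with $\phi(a_i,a_j)=\phi(a_j,a_k)=$ blue and $\phi(a_i,a_k)=$ red). -}

module Defs where

open import Data.Nat using (ℕ; zero; suc; _^_; _≤ᵇ_; _*_)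
open import Data.Bool using (if_then_else_)
open import Data.Fin using (Fin)
open import Relation.Binary.PropositionalEquality using (_≡_)

data Colour : Set where
  red blue : Colour

rootSearch : ℕ → ℕ → ℕ → ℕ
rootSearch q x zero = zero
rootSearch q x (suc m) = if (suc m ^ q) ≤ᵇ x then suc m else rootSearch q x m

-- ⌊ x ^ (1/q) ⌋ for q ≥ 1 : the largest m with m ^ q ≤ x (note m ≤ m ^ q ≤ x).
floorRoot : ℕ → ℕ → ℕ
floorRoot q x = rootSearch q x x

-- ⌊ 2 ^ (c n) ⌋ for the rational exponent c = p / q  (q ≥ 1):
-- 2^(pn/q) = (2^(pn))^(1/q).
floor2^ : (p q n : ℕ) → ℕ
floor2^ p q n = floorRoot q (2 ^ (p * n))

record Colouring (N : ℕ) : Set where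
  field
    col  : Fin N → Fin N → Colour
    symm : ∀ a b → col a b ≡ col b a
open Colouring public

module Submission where

-- The proof is the probabilistic method, phrased as counting.  A colouring is a
-- vector v ∈ {0,1}^(N²), one bit per pair; an event is a Boolean function of v
-- and count f the number of v satisfying it.
-- Then: (1) fails for given disjoint n-tuples with probability 2·2^(-n²); for
-- (2), with m = ⌊n/4⌋, each n-tuple carries m² edge-disjoint triangles
-- (x, m+y, 2m+x+y), all avoiding the pattern with probability (7/8)^(m²).  A
-- union bound over tuples and N^300 ≤ 2^n make both bad events rarer than 1/2,
-- so some colouring is good.  If N < n there are no n-sets at all.

open import Defs
open import Function using (_∘_; id)
open import Data.Empty using (⊥; ⊥-elim)
open import Data.Product using (Σ; ∃; _×_; _,_; proj₁; proj₂)
open import Data.Sum using (_⊎_; inj₁; inj₂; [_,_]′)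
open import Data.Bool using (Bool; true; false; _∧_; _∨_; not; if_then_else_; T)
open import Data.Bool.Properties using (∨-zeroʳ)
open import Data.Nat
open import Data.Nat.Properties
open import Data.Nat.DivMod using (_/_; _%_; m/n*n≤m; m≡m%n+[m/n]*n; m%n<n)
open import Data.Nat.Solver using (module +-*-Solver)
open import Data.Fin as F using (Fin; zero; suc)
import Data.Fin.Properties as F
open import Data.Fin.Subset using (Subset; _∈_; _∉_; ∣_∣; inside; outside)
open import Data.Fin.Subset.Properties using (∣p∣≤n)
open import Data.Vec using (Vec; []; _∷_; lookup; map; here; there)
open import Data.Vec.Properties using (lookup-map)
open import Data.List as L using (List; []; _∷_; length; allFin; upTo; cartesianProduct)
open import Data.List.Properties using (length-map; length-++; length-tabulate; length-upTo)
open import Data.List.Relation.Unary.All as All using (All; []; _∷_; universal)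
import Data.List.Relation.Unary.All.Properties as AllP
open import Data.List.Relation.Unary.Any using (Any; here; there)
open import Data.List.Relation.Unary.AllPairs as AllPairs using (AllPairs; []; _∷_)
import Data.List.Relation.Unary.AllPairs.Properties as AllPairsP
open import Data.List.Relation.Unary.Unique.Propositional.Properties using (cartesianProduct⁺; allFin⁺; upTo⁺)
open import Data.List.Membership.Propositional.Properties using (∈-cartesianProduct⁻; ∈-upTo⁻)
open import Relation.Nullary using (Dec; yes; no; does; _→-dec_; ¬?; ¬_)
open import Relation.Nullary.Decidable using (dec-true; dec-false)
open import Relation.Binary.Definitions using (tri<; tri≈; tri>)
open import Relation.Binary.PropositionalEquality
open +-*-Solver

true≢false : true ≢ false
true≢false ()

∨-trueˡ : ∀ {x} y → x ≡ true → x ∨ y ≡ true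
∨-trueˡ y refl = refl

∨-trueʳ : ∀ x {y} → y ≡ true → x ∨ y ≡ true
∨-trueʳ x refl = ∨-zeroʳ x

∧-true : ∀ x {y} → x ∧ y ≡ true → x ≡ true × y ≡ true
∧-true true e = refl , e

∧-falseʳ : ∀ {x} y → x ≡ true → x ∧ y ≡ false → y ≡ false
∧-falseʳ y refl e = e

∨-falseˡ : ∀ x {y} → x ∨ y ≡ false → x ≡ false
∨-falseˡ false _ = refl

∨-falseʳ : ∀ x {y} → x ∨ y ≡ false → y ≡ false
∨-falseʳ false e = e

not-false : ∀ {x} → not x ≡ false → x ≡ true
not-false {true} _ = refl

from-does : ∀ {A : Set} (d : Dec A) → does d ≡ true → A
from-does (yes a) _ = a

length-cartesianProduct : ∀ {A B : Set} (xs : List A) (ys : List B) →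
  length (cartesianProduct xs ys) ≡ length xs * length ys
length-cartesianProduct []       ys = refl
length-cartesianProduct (x ∷ xs) ys =
  trans (length-++ (L.map (x ,_) ys)) (cong₂ _+_ (length-map (x ,_) ys) (length-cartesianProduct xs ys))

allPairs-distinct : ∀ {A : Set} {Q : A → Set} (R : A → A → Set) {xs} → All Q xs → AllPairs _≢_ xs →
  (∀ {x y} → Q x → Q y → x ≢ y → R x y) → AllPairs R xs
allPairs-distinct R []       []         rel = []
allPairs-distinct R (q ∷ qs) (ds ∷ dss) rel = related qs ds ∷ allPairs-distinct R qs dss rel
  where
  related : ∀ {ys} → All _ ys → All (_ ≢_) ys → All (R _) ys
  related []         []         = []
  related (q′ ∷ qs′) (d ∷ ds′) = rel q q′ d ∷ related qs′ ds′

at : ∀ {A : Set} {k} → A → Vec A k → ℕ → A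
at d []       I       = d
at d (x ∷ xs) zero    = x
at d (x ∷ xs) (suc I) = at d xs I

at-lookup : ∀ {A : Set} {k} (d : A) (t : Vec A k) I (I<k : I < k) → at d t I ≡ lookup t (F.fromℕ< I<k)
at-lookup d (x ∷ xs) zero    _         = refl
at-lookup d (x ∷ xs) (suc I) (s≤s I<k) = at-lookup d xs I I<k

-- An event is a Boolean function of a colour vector v ∈ {0,1}^M, and
-- count f is the number of vectors satisfying it (2^M times its probability).
count : ∀ {M} → (Vec Bool M → Bool) → ℕ
count {zero}  f = if f [] then 1 else 0
count {suc M} f = count (λ v → f (true ∷ v)) + count (λ v → f (false ∷ v))

count-ext : ∀ {M} (f g : Vec Bool M → Bool) → (∀ v → f v ≡ g v) → count f ≡ count g
count-ext {zero}  f g f≗g rewrite f≗g [] = refl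
count-ext {suc M} f g f≗g =
  cong₂ _+_ (count-ext _ _ (λ v → f≗g (true ∷ v))) (count-ext _ _ (λ v → f≗g (false ∷ v)))

count-true : ∀ {M} → count {M} (λ _ → true) ≡ 2 ^ M
count-true {zero}  = refl
count-true {suc M} = cong₂ _+_ (count-true {M}) (trans (count-true {M}) (sym (+-identityʳ _)))

count-false : ∀ {M} → count {M} (λ _ → false) ≡ 0
count-false {zero}  = refl
count-false {suc M} = cong₂ _+_ (count-false {M}) (count-false {M})

count-∨ : ∀ {M} (f g : Vec Bool M → Bool) → count (λ v → f v ∨ g v) ≤ count f + count g
count-∨ {zero} f g with f [] | g []
... | true  | true  = s≤s z≤n
... | true  | false = ≤-refl
... | false | _     = ≤-refl
count-∨ {suc M} f g = begin
  count (λ v → f (true ∷ v) ∨ g (true ∷ v)) + count (λ v → f (false ∷ v) ∨ g (false ∷ v))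
    ≤⟨ +-mono-≤ (count-∨ (λ v → f (true ∷ v)) (λ v → g (true ∷ v)))
                (count-∨ (λ v → f (false ∷ v)) (λ v → g (false ∷ v))) ⟩
  (f₁ + g₁) + (f₀ + g₀)  ≡⟨ solve 4 (λ a b c d → (a :+ b) :+ (c :+ d) := (a :+ c) :+ (b :+ d)) refl f₁ g₁ f₀ g₀ ⟩
  (f₁ + f₀) + (g₁ + g₀)  ∎
  where
  open ≤-Reasoning
  f₁ = count (λ v → f (true ∷ v))
  f₀ = count (λ v → f (false ∷ v))
  g₁ = count (λ v → g (true ∷ v))
  g₀ = count (λ v → g (false ∷ v))

count-not : ∀ {M} (f : Vec Bool M → Bool) → count (λ v → not (f v)) + count f ≡ 2 ^ M
count-not {zero} f with f []
... | true  = refl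
... | false = refl
count-not {suc M} f = begin
  (n₁ + n₀) + (f₁ + f₀)  ≡⟨ solve 4 (λ a b c d → (a :+ b) :+ (c :+ d) := (a :+ c) :+ (b :+ d)) refl n₁ n₀ f₁ f₀ ⟩
  (n₁ + f₁) + (n₀ + f₀)  ≡⟨ cong₂ _+_ (count-not (λ v → f (true ∷ v))) (count-not (λ v → f (false ∷ v))) ⟩
  2 ^ M + 2 ^ M          ≡⟨ cong (2 ^ M +_) (sym (+-identityʳ (2 ^ M))) ⟩
  2 ^ suc M              ∎
  where
  open ≡-Reasoning
  n₁ = count (λ v → not (f (true ∷ v)))
  n₀ = count (λ v → not (f (false ∷ v)))
  f₁ = count (λ v → f (true ∷ v))
  f₀ = count (λ v → f (false ∷ v))

avoid : ∀ {M} (f : Vec Bool M → Bool) → count f < 2 ^ M → ∃ λ v → f v ≡ false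
avoid {zero} f lt with f [] in eq
... | true  = ⊥-elim (<-irrefl refl lt)
... | false = [] , eq
avoid {suc M} f lt with count (λ v → f (true ∷ v)) <? 2 ^ M
... | yes lt₁ = let v , e = avoid _ lt₁ in true ∷ v , e
... | no ¬lt₁ = let v , e = avoid _ lt₀ in false ∷ v , e
  where
  lt₀ : count (λ v → f (false ∷ v)) < 2 ^ M
  lt₀ = +-cancelˡ-< (2 ^ M) _ _ (≤-<-trans (+-monoˡ-≤ _ (≮⇒≥ ¬lt₁))
          (subst (count f <_) (cong (2 ^ M +_) (+-identityʳ (2 ^ M))) lt))

count-guarded : ∀ {M} (g : Bool) (f : Vec Bool M → Bool) W B →
  (g ≡ true → count f * W ≤ B) → count (λ v → g ∧ f v) * W ≤ B
count-guarded {M} false f W B _ rewrite count-false {M} = z≤n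
count-guarded     true  f W B bound = bound refl

is : Bool → Bool → Bool
is true  x = x
is false x = not x

literal : ∀ {M} → Fin M → Bool → Vec Bool M → Bool
literal p b v = is b (lookup v p)

count-literal : ∀ {M} (p : Fin M) b → count (literal p b) * 2 ≡ 2 ^ M
count-literal {suc M} zero true
  rewrite count-true {M} | count-false {M} = trans (cong (_* 2) (+-identityʳ (2 ^ M))) (*-comm (2 ^ M) 2)
count-literal {suc M} zero false
  rewrite count-true {M} | count-false {M} = *-comm (2 ^ M) 2
count-literal {suc M} (suc p) b = begin
  (c + c) * 2  ≡⟨ solve 1 (λ c → (c :+ c) :* con 2 := con 2 :* (c :* con 2)) refl c ⟩
  2 * (c * 2)  ≡⟨ cong (2 *_) (count-literal p b) ⟩
  2 ^ suc M    ∎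
  where
  open ≡-Reasoning
  c = count (literal p b)

Support : ℕ → Set
Support M = Fin M → Bool

DependsOn : ∀ {M} → Support M → (Vec Bool M → Bool) → Set
DependsOn D f = ∀ v w → (∀ p → D p ≡ true → lookup v p ≡ lookup w p) → f v ≡ f w

Disjoint : ∀ {M} → Support M → Support M → Set
Disjoint D E = ∀ p → D p ≡ true → E p ≡ false

dependsOn-tail : ∀ {M} (D : Support (suc M)) f b → DependsOn D f →
  DependsOn (λ p → D (suc p)) (λ v → f (b ∷ v))
dependsOn-tail D f b dep v w agree = dep (b ∷ v) (b ∷ w) λ { zero _ → refl ; (suc p) e → agree p e }

dependsOn-head : ∀ {M} (D : Support (suc M)) f → DependsOn D f → D zero ≡ false →
  ∀ v → f (true ∷ v) ≡ f (false ∷ v)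
dependsOn-head D f dep D₀≡false v = dep (true ∷ v) (false ∷ v) agree
  where
  agree : ∀ p → D p ≡ true → lookup (true ∷ v) p ≡ lookup (false ∷ v) p
  agree zero    D₀≡true = ⊥-elim (true≢false (trans (sym D₀≡true) D₀≡false))
  agree (suc p) _       = refl

-- The arithmetic of one induction step of the product rule: if one of the two
-- factors does not see the first bit, the two halves of the cube combine.
combine-halves : ∀ X Y P a₁ a₀ c₁ c₀ → X * P ≡ a₁ * c₁ → Y * P ≡ a₀ * c₀ →
  a₁ ≡ a₀ ⊎ c₁ ≡ c₀ → (X + Y) * (2 * P) ≡ (a₁ + a₀) * (c₁ + c₀)
combine-halves X Y P a₁ a₀ c₁ c₀ eX eY same = begin
  (X + Y) * (2 * P)              ≡⟨ solve 3 (λ X Y P → (X :+ Y) :* (con 2 :* P) := con 2 :* (X :* P) :+ con 2 :* (Y :* P)) refl X Y P ⟩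
  2 * (X * P) + 2 * (Y * P)      ≡⟨ cong₂ (λ x y → 2 * x + 2 * y) eX eY ⟩
  2 * (a₁ * c₁) + 2 * (a₀ * c₀)  ≡⟨ regroup same ⟩
  (a₁ + a₀) * (c₁ + c₀)          ∎
  where
  open ≡-Reasoning
  regroup : a₁ ≡ a₀ ⊎ c₁ ≡ c₀ → 2 * (a₁ * c₁) + 2 * (a₀ * c₀) ≡ (a₁ + a₀) * (c₁ + c₀)
  regroup (inj₁ refl) = solve 3 (λ a c d → con 2 :* (a :* c) :+ con 2 :* (a :* d) := (a :+ a) :* (c :+ d)) refl a₁ c₁ c₀
  regroup (inj₂ refl) = solve 3 (λ a b c → con 2 :* (a :* c) :+ con 2 :* (b :* c) := (a :+ b) :* (c :+ c)) refl a₁ a₀ c₁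

count-independent : ∀ {M} (D E : Support M) (f g : Vec Bool M → Bool) →
  DependsOn D f → DependsOn E g → Disjoint D E →
  count (λ v → f v ∧ g v) * 2 ^ M ≡ count f * count g
count-independent {zero} D E f g _ _ _ with f [] | g []
... | true  | true  = refl
... | true  | false = refl
... | false | _     = refl
count-independent {suc M} D E f g dep-f dep-g disjoint =
  combine-halves (count (λ v → f (true ∷ v) ∧ g (true ∷ v))) (count (λ v → f (false ∷ v) ∧ g (false ∷ v)))
    (2 ^ M) _ _ _ _ (on-half true) (on-half false) first-bit-irrelevant
  where
  on-half : ∀ b → count (λ v → f (b ∷ v) ∧ g (b ∷ v)) * 2 ^ M
                  ≡ count (λ v → f (b ∷ v)) * count (λ v → g (b ∷ v))
  on-half b = count-independent (λ p → D (suc p)) (λ p → E (suc p)) _ _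
    (dependsOn-tail D f b dep-f) (dependsOn-tail E g b dep-g) (λ p → disjoint (suc p))

  first-bit-irrelevant : count (λ v → f (true ∷ v)) ≡ count (λ v → f (false ∷ v))
                       ⊎ count (λ v → g (true ∷ v)) ≡ count (λ v → g (false ∷ v))
  first-bit-irrelevant with D zero in D₀ | E zero in E₀
  ... | false | _     = inj₁ (count-ext _ _ (dependsOn-head D f dep-f D₀))
  ... | true  | false = inj₂ (count-ext _ _ (dependsOn-head E g dep-g E₀))
  ... | true  | true  with () ← trans (sym E₀) (disjoint zero D₀)

allOf : ∀ {M} {I : Set} → (I → Vec Bool M → Bool) → List I → Vec Bool M → Bool
allOf F []       v = true
allOf F (i ∷ is) v = F i v ∧ allOf F is v

supportOf : ∀ {M} {I : Set} → (I → Support M) → List I → Support M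
supportOf D []       p = false
supportOf D (i ∷ is) p = D i p ∨ supportOf D is p

allOf-true : ∀ {M} {I : Set} (F : I → Vec Bool M → Bool) L v →
  All (λ i → F i v ≡ true) L → allOf F L v ≡ true
allOf-true F []       v []         = refl
allOf-true F (i ∷ is) v (Fi ∷ Fis) rewrite Fi = allOf-true F is v Fis

allOf-false : ∀ {M} {I : Set} (Q : I → Set) (F : I → Vec Bool M → Bool) L v →
  All Q L → allOf F L v ≡ false → ∃ λ i → Q i × F i v ≡ false
allOf-false Q F (i ∷ is) v (q ∷ qs) fails with F i v in Fi
... | false = i , q , Fi
... | true  = allOf-false Q F is v qs fails

allOf-dependsOn : ∀ {M} {I : Set} (D : I → Support M) (F : I → Vec Bool M → Bool) →
  (∀ i → DependsOn (D i) (F i)) → ∀ L → DependsOn (supportOf D L) (allOf F L)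
allOf-dependsOn D F dep []       v w agree = refl
allOf-dependsOn D F dep (i ∷ is) v w agree =
  cong₂ _∧_ (dep i v w (λ p e → agree p (∨-trueˡ _ e)))
            (allOf-dependsOn D F dep is v w (λ p e → agree p (∨-trueʳ (D i p) e)))

disjoint-supportOf : ∀ {M} {I : Set} (D : I → Support M) i L →
  All (λ j → Disjoint (D i) (D j)) L → Disjoint (D i) (supportOf D L)
disjoint-supportOf D i []       []           p e = refl
disjoint-supportOf D i (j ∷ js) (dj ∷ djs) p e
  rewrite dj p e | disjoint-supportOf D i js djs p e = refl

count-allOf : ∀ {M} {I : Set} (D : I → Support M) (F : I → Vec Bool M → Bool) (K s : ℕ) →
  (∀ i → DependsOn (D i) (F i)) → (L : List I) → AllPairs (λ i j → Disjoint (D i) (D j)) L →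
  All (λ i → count (F i) * K ≡ s * 2 ^ M) L →
  count (allOf F L) * K ^ length L ≡ s ^ length L * 2 ^ M
count-allOf {M} D F K s dep [] [] [] =
  trans (cong (_* 1) (count-true {M})) (trans (*-identityʳ _) (sym (+-identityʳ _)))
count-allOf {M} D F K s dep (i ∷ is) (disj ∷ disjs) (eq ∷ eqs) =
  *-cancelʳ-≡ _ _ P {{m^n≢0 2 M}} (begin
    (c * (K * K ^ l)) * P    ≡⟨ solve 4 (λ c K Kl P → (c :* (K :* Kl)) :* P := (c :* P) :* (K :* Kl)) refl c K (K ^ l) P ⟩
    (c * P) * (K * K ^ l)    ≡⟨ cong (_* (K * K ^ l)) independent ⟩
    (a * r) * (K * K ^ l)    ≡⟨ solve 4 (λ a r K Kl → (a :* r) :* (K :* Kl) := (a :* K) :* (r :* Kl)) refl a r K (K ^ l) ⟩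
    (a * K) * (r * K ^ l)    ≡⟨ cong₂ _*_ eq (count-allOf D F K s dep is disjs eqs) ⟩
    (s * P) * (s ^ l * P)    ≡⟨ solve 3 (λ s P sl → (s :* P) :* (sl :* P) := ((s :* sl) :* P) :* P) refl s P (s ^ l) ⟩
    ((s * s ^ l) * P) * P    ∎)
  where
  open ≡-Reasoning
  l = length is
  P = 2 ^ M
  c = count (λ v → F i v ∧ allOf F is v)
  a = count (F i)
  r = count (allOf F is)
  independent : c * P ≡ a * r
  independent = count-independent (D i) (supportOf D is) (F i) (allOf F is)
    (dep i) (allOf-dependsOn D F dep is) (disjoint-supportOf D i is disj)

singleton : ∀ {M} → Fin M → Support M
singleton e p = does (p F.≟ e)

singleton-disjoint : ∀ {M} {e e′ : Fin M} → e ≢ e′ → Disjoint (singleton e) (singleton e′)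
singleton-disjoint {e = e} {e′} e≢e′ p p∈e with p F.≟ e
... | yes refl = dec-false (p F.≟ e′) e≢e′

Pattern : ℕ → Set
Pattern M = List (Fin M × Bool)

holds : ∀ {M} → Fin M × Bool → Vec Bool M → Bool
holds (p , b) = literal p b

matches : ∀ {M} → Pattern M → Vec Bool M → Bool
matches = allOf holds

coordinates : ∀ {M} → Pattern M → Support M
coordinates = supportOf (λ x → singleton (proj₁ x))

Distinct : ∀ {M} → Pattern M → Set
Distinct = AllPairs (λ x y → proj₁ x ≢ proj₁ y)

holds-dependsOn : ∀ {M} (x : Fin M × Bool) → DependsOn (singleton (proj₁ x)) (holds x)
holds-dependsOn (p , b) v w agree = cong (is b) (agree p (dec-true (p F.≟ p) refl))

matches-dependsOn : ∀ {M} (ps : Pattern M) → DependsOn (coordinates ps) (matches ps)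
matches-dependsOn = allOf-dependsOn _ holds holds-dependsOn

coordinates-member : ∀ {M} (ps : Pattern M) p → coordinates ps p ≡ true → Any (λ x → p ≡ proj₁ x) ps
coordinates-member ((q , _) ∷ ps) p e with p F.≟ q
... | yes p≡q = here p≡q
... | no  _   = there (coordinates-member ps p e)

coordinates-absent : ∀ {M} (ps : Pattern M) p → All (λ x → p ≢ proj₁ x) ps → coordinates ps p ≡ false
coordinates-absent []             p []           = refl
coordinates-absent ((q , _) ∷ ps) p (p≢q ∷ p∉ps)
  rewrite dec-false (p F.≟ q) p≢q = coordinates-absent ps p p∉ps

count-matches : ∀ {M} (ps : Pattern M) → Distinct ps → count (matches ps) * 2 ^ length ps ≡ 2 ^ M
count-matches {M} ps distinct = begin
  count (matches ps) * 2 ^ length ps  ≡⟨ count-allOf _ holds 2 1 holds-dependsOn ps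
                                          (AllPairs.map singleton-disjoint distinct)
                                          (universal (λ { (p , b) → trans (count-literal p b) (sym (*-identityˡ _)) }) ps) ⟩
  1 ^ length ps * 2 ^ M               ≡⟨ cong (_* 2 ^ M) (^-zeroˡ (length ps)) ⟩
  1 * 2 ^ M                           ≡⟨ *-identityˡ _ ⟩
  2 ^ M                               ∎
  where open ≡-Reasoning

anyFin : ∀ {M} N → (Fin N → Vec Bool M → Bool) → Vec Bool M → Bool
anyFin zero    P v = false
anyFin (suc N) P v = P zero v ∨ anyFin N (λ x → P (suc x)) v

anyTuple : ∀ {M} N k → (Vec (Fin N) k → Vec Bool M → Bool) → Vec Bool M → Bool
anyTuple N zero    P = P []
anyTuple N (suc k) P = anyFin N (λ x → anyTuple N k (λ t → P (x ∷ t)))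

count-anyFin : ∀ {M} N (P : Fin N → Vec Bool M → Bool) W B →
  (∀ x → count (P x) * W ≤ B) → count (anyFin N P) * W ≤ N * B
count-anyFin {M} zero    P W B bound rewrite count-false {M} = z≤n
count-anyFin     (suc N) P W B bound = begin
  count (λ v → P zero v ∨ anyFin N P′ v) * W          ≤⟨ *-monoˡ-≤ W (count-∨ (P zero) (anyFin N P′)) ⟩
  (count (P zero) + count (anyFin N P′)) * W         ≡⟨ *-distribʳ-+ W (count (P zero)) _ ⟩
  count (P zero) * W + count (anyFin N P′) * W       ≤⟨ +-mono-≤ (bound zero) (count-anyFin N P′ W B (λ x → bound (suc x))) ⟩
  B + N * B                                          ∎
  where
  open ≤-Reasoning
  P′ = λ x → P (suc x)

count-anyTuple : ∀ {M} N k (P : Vec (Fin N) k → Vec Bool M → Bool) W B →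
  (∀ t → count (P t) * W ≤ B) → count (anyTuple N k P) * W ≤ N ^ k * B
count-anyTuple N zero    P W B bound = subst (_ ≤_) (sym (+-identityʳ B)) (bound [])
count-anyTuple N (suc k) P W B bound = subst (count (anyTuple N (suc k) P) * W ≤_) (sym (*-assoc N (N ^ k) B))
  (count-anyFin N (λ x → anyTuple N k (λ t → P (x ∷ t))) W (N ^ k * B)
    (λ x → count-anyTuple N k (λ t → P (x ∷ t)) W B (λ t → bound (x ∷ t))))

anyFin-false : ∀ {M} N (P : Fin N → Vec Bool M → Bool) v → anyFin N P v ≡ false → ∀ x → P x v ≡ false
anyFin-false (suc N) P v none zero    = ∨-falseˡ (P zero v) none
anyFin-false (suc N) P v none (suc x) = anyFin-false N (λ x → P (suc x)) v (∨-falseʳ (P zero v) none) x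

anyTuple-false : ∀ {M} N k (P : Vec (Fin N) k → Vec Bool M → Bool) v → anyTuple N k P v ≡ false →
  ∀ t → P t v ≡ false
anyTuple-false N zero    P v none []      = none
anyTuple-false N (suc k) P v none (x ∷ t) =
  anyTuple-false N k (λ t → P (x ∷ t)) v (anyFin-false N _ v none x) t

pair : ∀ {N} → Fin N → Fin N → Fin (N * N)
pair a b = if does (a F.<? b) then F.combine a b else F.combine b a

pair-sym : ∀ {N} (a b : Fin N) → pair a b ≡ pair b a
pair-sym a b with F.<-cmp a b
... | tri< a<b _ b≮a rewrite dec-true (a F.<? b) a<b | dec-false (b F.<? a) b≮a = refl
... | tri≈ _ refl _ = refl
... | tri> a≮b _ b<a rewrite dec-false (a F.<? b) a≮b | dec-true (b F.<? a) b<a = refl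

pair-injective : ∀ {N} (a b c d : Fin N) → pair a b ≡ pair c d → (a ≡ c × b ≡ d) ⊎ (a ≡ d × b ≡ c)
pair-injective a b c d e with does (a F.<? b) | does (c F.<? d)
... | true  | true  = inj₁ (F.combine-injective a b c d e)
... | true  | false = inj₂ (F.combine-injective a b d c e)
... | false | true  = let b≡c , a≡d = F.combine-injective b a c d e in inj₂ (a≡d , b≡c)
... | false | false = let b≡d , a≡c = F.combine-injective b a d c e in inj₁ (a≡c , b≡d)

bitColour : Bool → Colour
bitColour true  = red
bitColour false = blue

colourBit : Colour → Bool
colourBit red  = true
colourBit blue = false

colouring : ∀ {N} → Vec Bool (N * N) → Colouring N
colouring v = record
  { col  = λ a b → bitColour (lookup v (pair a b))
  ; symm = λ a b → cong (λ p → bitColour (lookup v p)) (pair-sym a b) }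

colour⇒literal : ∀ {N} (v : Vec Bool (N * N)) (a b : Fin N) c →
  col (colouring {N} v) a b ≡ c → literal (pair a b) (colourBit c) v ≡ true
colour⇒literal v a b c refl with lookup v (pair a b)
... | true  = refl
... | false = refl

literal⇒colour : ∀ {N} (v : Vec Bool (N * N)) (a b : Fin N) c →
  literal (pair a b) (colourBit c) v ≡ true → col (colouring {N} v) a b ≡ c
literal⇒colour v a b red  e rewrite e = refl
literal⇒colour v a b blue e with lookup v (pair a b)
literal⇒colour v a b blue refl | false = refl

Increasing : ∀ {N k} → Vec (Fin N) k → Set
Increasing {k = k} t = ∀ (i j : Fin k) → i F.< j → lookup t i F.< lookup t j

increasing? : ∀ {N k} (t : Vec (Fin N) k) → Dec (Increasing t)
increasing? t = F.all? λ i → F.all? λ j → (i F.<? j) →-dec (lookup t i F.<? lookup t j)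

increasing-injective : ∀ {N k} (t : Vec (Fin N) k) → Increasing t → ∀ i j → lookup t i ≡ lookup t j → i ≡ j
increasing-injective t inc i j e with F.<-cmp i j
... | tri< i<j _ _ = ⊥-elim (F.<-irrefl e (inc i j i<j))
... | tri≈ _ i≡j _ = i≡j
... | tri> _ _ j<i = ⊥-elim (F.<-irrefl (sym e) (inc j i j<i))

Listing : ∀ {N} → Subset N → ℕ → Set
Listing {N} A n = Σ (Vec (Fin N) n) λ t → Increasing t × (∀ i → lookup t i ∈ A)

listing : ∀ {N} (A : Subset N) → Listing A ∣ A ∣
listing []            = [] , (λ ()) , (λ ())
listing (outside ∷ A) with listing A
... | t , inc , mem = map F.suc t , inc′ , mem′
  where
  inc′ : Increasing (map F.suc t)
  inc′ i j i<j rewrite lookup-map i F.suc t | lookup-map j F.suc t = s≤s (inc i j i<j)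
  mem′ : ∀ i → lookup (map F.suc t) i ∈ outside ∷ A
  mem′ i rewrite lookup-map i F.suc t = there (mem i)
listing (inside ∷ A) with listing A
... | t , inc , mem = zero ∷ map F.suc t , inc′ , mem′
  where
  inc′ : Increasing (zero ∷ map F.suc t)
  inc′ zero    (suc j) _         rewrite lookup-map j F.suc t = s≤s z≤n
  inc′ (suc i) (suc j) (s≤s i<j) rewrite lookup-map i F.suc t | lookup-map j F.suc t = s≤s (inc i j i<j)
  mem′ : ∀ i → lookup (zero ∷ map F.suc t) i ∈ inside ∷ A
  mem′ zero    = here
  mem′ (suc i) rewrite lookup-map i F.suc t = there (mem i)

listing-of-size : ∀ {N} (A : Subset N) {n} → ∣ A ∣ ≡ n → Listing A n
listing-of-size A refl = listing A

module Bipartite {N n : ℕ} (a b : Vec (Fin N) n) where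

  Apart : Set
  Apart = ∀ i j → lookup a i ≢ lookup b j

  apart? : Dec Apart
  apart? = F.all? λ i → F.all? λ j → ¬? (lookup a i F.≟ lookup b j)

  cells : List (Fin n × Fin n)
  cells = cartesianProduct (allFin n) (allFin n)

  crossPair : Fin n × Fin n → Fin (N * N)
  crossPair (i , j) = pair (lookup a i) (lookup b j)

  monochromatic : Colour → Pattern (N * N)
  monochromatic c = L.map (λ ij → crossPair ij , colourBit c) cells

  admissible : Bool
  admissible = does (increasing? a) ∧ (does (increasing? b) ∧ does apart?)

  event : Vec Bool (N * N) → Bool
  event v = admissible ∧ (matches (monochromatic red) v ∨ matches (monochromatic blue) v)

  crossPair-injective : Increasing a → Increasing b → Apart → ∀ ij kl → crossPair ij ≡ crossPair kl → ij ≡ kl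
  crossPair-injective inc-a inc-b apart (i , j) (k , l) e with pair-injective _ _ _ _ e
  ... | inj₁ (aᵢ≡aₖ , bⱼ≡bₗ) =
    cong₂ _,_ (increasing-injective a inc-a i k aᵢ≡aₖ) (increasing-injective b inc-b j l bⱼ≡bₗ)
  ... | inj₂ (aᵢ≡bₗ , _)     = ⊥-elim (apart i l aᵢ≡bₗ)

  monochromatic-distinct : Increasing a → Increasing b → Apart → ∀ c → Distinct (monochromatic c)
  monochromatic-distinct inc-a inc-b apart c = AllPairsP.map⁺
    (AllPairs.map (λ ij≢kl e → ij≢kl (crossPair-injective inc-a inc-b apart _ _ e))
                  (cartesianProduct⁺ (allFin⁺ n) (allFin⁺ n)))

  length-monochromatic : ∀ c → length (monochromatic c) ≡ n * n
  length-monochromatic c = trans (length-map _ cells)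
    (trans (length-cartesianProduct (allFin n) (allFin n)) (cong₂ _*_ (length-tabulate {n = n} id) (length-tabulate {n = n} id)))

  admissible-sound : admissible ≡ true → Increasing a × Increasing b × Apart
  admissible-sound adm with ∧-true (does (increasing? a)) adm
  ... | inc-a , rest with ∧-true (does (increasing? b)) rest
  ... | inc-b , apt = from-does (increasing? a) inc-a , from-does (increasing? b) inc-b , from-does apart? apt

  count-event : count event * 2 ^ (n * n) ≤ 2 * 2 ^ (N * N)
  count-event = count-guarded admissible (λ v → matches (monochromatic red) v ∨ matches (monochromatic blue) v) W _ λ adm →
    let inc-a , inc-b , apart = admissible-sound adm in either-colour inc-a inc-b apart
    where
    open ≤-Reasoning
    W = 2 ^ (n * n)
    P = 2 ^ (N * N)
    count-mono : Increasing a → Increasing b → Apart → ∀ c → count (matches (monochromatic c)) * W ≡ P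
    count-mono inc-a inc-b apart c = subst (λ k → count (matches (monochromatic c)) * 2 ^ k ≡ P)
      (length-monochromatic c) (count-matches (monochromatic c) (monochromatic-distinct inc-a inc-b apart c))
    either-colour : Increasing a → Increasing b → Apart →
      count (λ v → matches (monochromatic red) v ∨ matches (monochromatic blue) v) * W ≤ 2 * P
    either-colour inc-a inc-b apart = begin
      count (λ v → matches (monochromatic red) v ∨ matches (monochromatic blue) v) * W
        ≤⟨ *-monoˡ-≤ W (count-∨ (matches (monochromatic red)) (matches (monochromatic blue))) ⟩
      (count (matches (monochromatic red)) + count (matches (monochromatic blue))) * W
        ≡⟨ *-distribʳ-+ W (count (matches (monochromatic red))) _ ⟩
      count (matches (monochromatic red)) * W + count (matches (monochromatic blue)) * W
        ≡⟨ cong₂ _+_ (count-mono inc-a inc-b apart red) (count-mono inc-a inc-b apart blue) ⟩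
      P + P
        ≡⟨ cong (P +_) (sym (+-identityʳ P)) ⟩
      2 * P ∎

  event-intro : ∀ v → Increasing a → Increasing b → Apart →
    (Σ Colour λ c → ∀ i j → col (colouring {N} v) (lookup a i) (lookup b j) ≡ c) → event v ≡ true
  event-intro v inc-a inc-b apart (c , mono)
    rewrite dec-true (increasing? a) inc-a | dec-true (increasing? b) inc-b | dec-true apart? apart =
    either c (allOf-true holds (monochromatic c) v
      (AllP.map⁺ (universal (λ { (i , j) → colour⇒literal v (lookup a i) (lookup b j) c (mono i j) }) cells)))
    where
    either : ∀ c → matches (monochromatic c) v ≡ true →
      matches (monochromatic red) v ∨ matches (monochromatic blue) v ≡ true
    either red  e = ∨-trueˡ _ e
    either blue e = ∨-trueʳ _ e

-- A packing of m² edge-disjoint triangles on the vertex set {0, …, 4m-1}: the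
-- triangle (x , y), for x , y < m, has corners x < m + y < 2m + (x + y).
-- Each side determines both the triangle and which of its three sides it is.
module TrianglePacking (m : ℕ) where

  Triangle : Set
  Triangle = ℕ × ℕ

  Valid : Triangle → Set
  Valid (x , y) = x < m × y < m

  corner₁ corner₂ corner₃ : Triangle → ℕ
  corner₁ (x , y) = x
  corner₂ (x , y) = m + y
  corner₃ (x , y) = m + m + (x + y)

  side : Fin 3 → Triangle → ℕ × ℕ
  side zero             τ = corner₁ τ , corner₂ τ
  side (suc zero)       τ = corner₂ τ , corner₃ τ
  side (suc (suc zero)) τ = corner₁ τ , corner₃ τ

  corner₁<corner₂ : ∀ τ → Valid τ → corner₁ τ < corner₂ τ
  corner₁<corner₂ (x , y) (x<m , _) = <-≤-trans x<m (m≤m+n m y)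

  corner₂<corner₃ : ∀ τ → Valid τ → corner₂ τ < corner₃ τ
  corner₂<corner₃ (x , y) (_ , y<m) = <-≤-trans (+-monoʳ-< m y<m) (m≤m+n (m + m) (x + y))

  corner₃<4m : ∀ τ → Valid τ → corner₃ τ < m + m + (m + m)
  corner₃<4m (x , y) (x<m , y<m) = +-monoʳ-< (m + m) (+-mono-< x<m y<m)

  side-ordered : ∀ k τ → Valid τ → proj₁ (side k τ) < proj₂ (side k τ)
  side-ordered zero             τ v = corner₁<corner₂ τ v
  side-ordered (suc zero)       τ v = corner₂<corner₃ τ v
  side-ordered (suc (suc zero)) τ v = <-trans (corner₁<corner₂ τ v) (corner₂<corner₃ τ v)

  side-bounded : ∀ k τ → Valid τ → proj₂ (side k τ) < m + m + (m + m)
  side-bounded zero             τ v = <-trans (corner₂<corner₃ τ v) (corner₃<4m τ v)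
  side-bounded (suc zero)       τ v = corner₃<4m τ v
  side-bounded (suc (suc zero)) τ v = corner₃<4m τ v

  decode : ℕ × ℕ → Fin 3 × Triangle
  decode (I , J) =
    if does (J <? m + m) then (zero , I , J ∸ m)
    else if does (I <? m) then (suc (suc zero) , I , J ∸ (m + m) ∸ I)
    else (suc zero , J ∸ (m + m) ∸ (I ∸ m) , I ∸ m)

  decode-side : ∀ k τ → Valid τ → decode (side k τ) ≡ (k , τ)
  decode-side zero (x , y) (x<m , y<m)
    rewrite dec-true (m + y <? m + m) (+-monoʳ-< m y<m) | m+n∸m≡n m y = refl
  decode-side (suc zero) (x , y) (x<m , y<m)
    rewrite dec-false (m + m + (x + y) <? m + m) (m+n≮m (m + m) (x + y)) | dec-false (m + y <? m) (m+n≮m m y)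
          | m+n∸m≡n (m + m) (x + y) | m+n∸m≡n m y | m+n∸n≡m x y = refl
  decode-side (suc (suc zero)) (x , y) (x<m , y<m)
    rewrite dec-false (m + m + (x + y) <? m + m) (m+n≮m (m + m) (x + y)) | dec-true (x <? m) x<m
          | m+n∸m≡n (m + m) (x + y) | m+n∸m≡n x y = refl

  side-injective : ∀ k l τ τ′ → Valid τ → Valid τ′ → side k τ ≡ side l τ′ → k ≡ l × τ ≡ τ′
  side-injective k l τ τ′ v v′ e with trans (sym (decode-side k τ v)) (trans (cong decode e) (decode-side l τ′ v′))
  ... | refl = refl , refl

-- The event that an increasing tuple t contains no blue-blue-red triangle among
-- the m² triangles of the packing placed on its first 4m entries; the triangles
-- use disjoint pairs, so it has probability at most (7/8)^(m²).
module Triangles {N n : ℕ} (m : ℕ) (4m≤n : m + m + (m + m) ≤ suc n) (t : Vec (Fin N) (suc n)) where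

  open TrianglePacking m public

  s : ℕ → Fin N
  s = at (lookup t zero) t

  s-increasing : Increasing t → ∀ I J → I < J → J < suc n → s I F.< s J
  s-increasing inc I J I<J J<n
    rewrite at-lookup (lookup t zero) t I (<-trans I<J J<n) | at-lookup (lookup t zero) t J J<n =
    inc _ _ (subst₂ _<_ (sym (F.toℕ-fromℕ< (<-trans I<J J<n))) (sym (F.toℕ-fromℕ< J<n)) I<J)

  s-injective : Increasing t → ∀ I J → I < suc n → J < suc n → s I ≡ s J → I ≡ J
  s-injective inc I J I<n J<n e = begin
    I                          ≡⟨ sym (F.toℕ-fromℕ< I<n) ⟩
    F.toℕ (F.fromℕ< I<n)       ≡⟨ cong F.toℕ (increasing-injective t inc _ _ entries-equal) ⟩
    F.toℕ (F.fromℕ< J<n)       ≡⟨ F.toℕ-fromℕ< J<n ⟩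
    J                          ∎
    where
    open ≡-Reasoning
    entries-equal : lookup t (F.fromℕ< I<n) ≡ lookup t (F.fromℕ< J<n)
    entries-equal = trans (sym (at-lookup _ t I I<n)) (trans e (at-lookup _ t J J<n))

  side-in-range : ∀ k τ → Valid τ → proj₁ (side k τ) < suc n × proj₂ (side k τ) < suc n
  side-in-range k τ v = <-trans (side-ordered k τ v) J<n , J<n
    where
    J<n = <-≤-trans (side-bounded k τ v) 4m≤n

  edge : Fin 3 → Triangle → Fin (N * N)
  edge k τ = pair (s (proj₁ (side k τ))) (s (proj₂ (side k τ)))

  edge-injective : Increasing t → ∀ k l τ τ′ → Valid τ → Valid τ′ → edge k τ ≡ edge l τ′ → k ≡ l × τ ≡ τ′
  edge-injective inc k l τ τ′ v v′ e
    with pair-injective _ _ _ _ e | side-in-range k τ v | side-in-range l τ′ v′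
  ... | inj₁ (lo≡lo′ , hi≡hi′) | lo<n , hi<n | lo′<n , hi′<n = side-injective k l τ τ′ v v′
    (cong₂ _,_ (s-injective inc _ _ lo<n lo′<n lo≡lo′) (s-injective inc _ _ hi<n hi′<n hi≡hi′))
  ... | inj₂ (lo≡hi′ , hi≡lo′) | lo<n , hi<n | lo′<n , hi′<n = ⊥-elim (<-asym (side-ordered k τ v)
    (subst₂ _<_ (sym (s-injective inc _ _ hi<n lo′<n hi≡lo′)) (sym (s-injective inc _ _ lo<n hi′<n lo≡hi′))
            (side-ordered l τ′ v′)))

  forbidden : Triangle → Pattern (N * N)
  forbidden τ = (edge zero τ , colourBit blue) ∷ (edge (suc zero) τ , colourBit blue)
              ∷ (edge (suc (suc zero)) τ , colourBit red) ∷ []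

  avoids : Triangle → Vec Bool (N * N) → Bool
  avoids τ v = not (matches (forbidden τ) v)

  triangles : List Triangle
  triangles = cartesianProduct (upTo m) (upTo m)

  triangles-valid : All Valid triangles
  triangles-valid = All.tabulate λ τ∈ →
    let x∈ , y∈ = ∈-cartesianProduct⁻ (upTo m) (upTo m) τ∈ in ∈-upTo⁻ x∈ , ∈-upTo⁻ y∈

  event : Vec Bool (N * N) → Bool
  event v = does (increasing? t) ∧ allOf avoids triangles v

  forbidden-distinct : Increasing t → ∀ τ → Valid τ → Distinct (forbidden τ)
  forbidden-distinct inc τ v = (apart zero (suc zero) (λ ()) ∷ apart zero (suc (suc zero)) (λ ()) ∷ [])
                             ∷ (apart (suc zero) (suc (suc zero)) (λ ()) ∷ []) ∷ [] ∷ []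
    where
    apart : ∀ k l → k ≢ l → edge k τ ≢ edge l τ
    apart k l k≢l e = k≢l (proj₁ (edge-injective inc k l τ τ v v e))

  count-avoids : Increasing t → ∀ τ → Valid τ → count (avoids τ) * 8 ≡ 7 * 2 ^ (N * N)
  count-avoids inc τ v = +-cancelʳ-≡ (count (matches (forbidden τ)) * 8) _ _ (begin
    count (avoids τ) * 8 + count (matches (forbidden τ)) * 8   ≡⟨ sym (*-distribʳ-+ 8 (count (avoids τ)) _) ⟩
    (count (avoids τ) + count (matches (forbidden τ))) * 8     ≡⟨ cong (_* 8) (count-not (matches (forbidden τ))) ⟩
    P * 8                                                      ≡⟨ solve 1 (λ P → P :* con 8 := con 7 :* P :+ P) refl P ⟩
    7 * P + P
      ≡⟨ cong (7 * P +_) (sym (count-matches (forbidden τ) (forbidden-distinct inc τ v))) ⟩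
    7 * P + count (matches (forbidden τ)) * 8                  ∎)
    where
    open ≡-Reasoning
    P = 2 ^ (N * N)

  on-side : ∀ τ p → coordinates (forbidden τ) p ≡ true → ∃ λ k → p ≡ edge k τ
  on-side τ p p∈τ with coordinates-member (forbidden τ) p p∈τ
  ... | here p≡e                 = zero , p≡e
  ... | there (here p≡e)         = suc zero , p≡e
  ... | there (there (here p≡e)) = suc (suc zero) , p≡e

  forbidden-disjoint : Increasing t → ∀ {τ τ′} → Valid τ → Valid τ′ → τ ≢ τ′ →
    Disjoint (coordinates (forbidden τ)) (coordinates (forbidden τ′))
  forbidden-disjoint inc {τ} {τ′} v v′ τ≢τ′ p p∈τ =
    coordinates-absent (forbidden τ′) p (not-side zero ∷ not-side (suc zero) ∷ not-side (suc (suc zero)) ∷ [])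
    where
    k = proj₁ (on-side τ p p∈τ)
    not-side : ∀ l → p ≢ edge l τ′
    not-side l p≡e = τ≢τ′ (proj₂ (edge-injective inc k l τ τ′ v v′ (trans (sym (proj₂ (on-side τ p p∈τ))) p≡e)))

  count-event : count event * 8 ^ (m * m) ≤ 7 ^ (m * m) * 2 ^ (N * N)
  count-event = count-guarded (does (increasing? t)) (allOf avoids triangles) _ _ λ inc? →
    let inc = from-does (increasing? t) inc? in
    ≤-reflexive (subst (λ k → count (allOf avoids triangles) * 8 ^ k ≡ 7 ^ k * 2 ^ (N * N)) length-triangles
      (count-allOf (coordinates ∘ forbidden) avoids 8 7
        (λ τ v w agree → cong not (matches-dependsOn (forbidden τ) v w agree)) triangles
        (allPairs-distinct _ triangles-valid (cartesianProduct⁺ (upTo⁺ m) (upTo⁺ m)) (forbidden-disjoint inc))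
        (All.map (λ {τ} → count-avoids inc τ) triangles-valid)))
    where
    length-triangles : length triangles ≡ m * m
    length-triangles = trans (length-cartesianProduct (upTo m) (upTo m)) (cong₂ _*_ (length-upTo m) (length-upTo m))

  pattern-found : ∀ v → Increasing t → event v ≡ false →
    ∃ λ τ → Valid τ × col (colouring {N} v) (s (corner₁ τ)) (s (corner₂ τ)) ≡ blue
                    × col (colouring {N} v) (s (corner₂ τ)) (s (corner₃ τ)) ≡ blue
                    × col (colouring {N} v) (s (corner₁ τ)) (s (corner₃ τ)) ≡ red
  pattern-found v inc fails
    with allOf-false Valid avoids triangles v triangles-valid (∧-falseʳ _ (dec-true (increasing? t) inc) fails)
  ... | τ , valid , matched = τ , valid ,
    literal⇒colour v (s (corner₁ τ)) (s (corner₂ τ)) blue side₁₂ ,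
    literal⇒colour v (s (corner₂ τ)) (s (corner₃ τ)) blue side₂₃ ,
    literal⇒colour v (s (corner₁ τ)) (s (corner₃ τ)) red side₁₃
    where
    holds₁₂ = ∧-true _ (not-false matched)
    holds₂₃ = ∧-true _ (proj₂ holds₁₂)
    side₁₂ = proj₁ holds₁₂
    side₂₃ = proj₁ holds₂₃
    side₁₃ = proj₁ (∧-true _ (proj₂ holds₂₃))

^-distrib-* : ∀ a b c → (a * b) ^ c ≡ a ^ c * b ^ c
^-distrib-* a b zero    = refl
^-distrib-* a b (suc c) rewrite ^-distrib-* a b c =
  solve 4 (λ a b x y → (a :* b) :* (x :* y) := (a :* x) :* (b :* y)) refl a b (a ^ c) (b ^ c)

^-cancelʳ-< : ∀ Q x y → x ^ Q < y ^ Q → x < y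
^-cancelʳ-< Q x y lt with x <? y
... | yes x<y = x<y
... | no  x≮y = ⊥-elim (<⇒≱ lt (^-monoˡ-≤ Q (≮⇒≥ x≮y)))

^-cancelʳ-≤ : ∀ Q .{{_ : NonZero Q}} x y → x ^ Q ≤ y ^ Q → x ≤ y
^-cancelʳ-≤ Q x y le with x ≤? y
... | yes x≤y = x≤y
... | no  x≰y = ⊥-elim (<⇒≱ (^-monoˡ-< Q (≰⇒> x≰y)) le)

tuple-bound : ∀ N n Q → N ^ Q ≤ 2 ^ n → (N ^ n) ^ Q ≤ 2 ^ (n * n)
tuple-bound N n Q budget = begin
  (N ^ n) ^ Q   ≡⟨ ^-*-assoc N n Q ⟩
  N ^ (n * Q)   ≡⟨ cong (N ^_) (*-comm n Q) ⟩
  N ^ (Q * n)   ≡⟨ sym (^-*-assoc N Q n) ⟩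
  (N ^ Q) ^ n   ≤⟨ ^-monoˡ-≤ n budget ⟩
  (2 ^ n) ^ n   ≡⟨ ^-*-assoc 2 n n ⟩
  2 ^ (n * n)   ∎
  where open ≤-Reasoning

pairs-bound : ∀ Q N n → 6 ≤ Q → N ^ Q ≤ 2 ^ n → Q ≤ n → 2 * (2 * (N ^ n * N ^ n)) < 2 ^ (n * n)
pairs-bound Q N n 6≤Q budget Q≤n = ^-cancelʳ-< Q _ _ (begin-strict
  (2 * (2 * (a * a))) ^ Q      ≡⟨ cong (_^ Q) (solve 1 (λ a → con 2 :* (con 2 :* (a :* a)) := con 4 :* (a :* a)) refl a) ⟩
  (4 * (a * a)) ^ Q            ≡⟨ ^-distrib-* 4 (a * a) Q ⟩
  4 ^ Q * (a * a) ^ Q          ≡⟨ cong (4 ^ Q *_) (^-distrib-* a a Q) ⟩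
  4 ^ Q * (a ^ Q * a ^ Q)      ≤⟨ *-monoʳ-≤ (4 ^ Q) (*-mono-≤ (tuple-bound N n Q budget) (tuple-bound N n Q budget)) ⟩
  4 ^ Q * (2 ^ z * 2 ^ z)      ≡⟨ cong₂ _*_ (^-*-assoc 2 2 Q) (sym (^-distribˡ-+-* 2 z z)) ⟩
  2 ^ (2 * Q) * 2 ^ (z + z)    ≡⟨ sym (^-distribˡ-+-* 2 (2 * Q) (z + z)) ⟩
  2 ^ (2 * Q + (z + z))        <⟨ ^-monoʳ-< 2 (s≤s (s≤s z≤n)) exponents ⟩
  2 ^ (z * Q)                  ≡⟨ sym (^-*-assoc 2 z Q) ⟩
  (2 ^ z) ^ Q                  ∎)
  where
  open ≤-Reasoning
  a = N ^ n
  z = n * n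
  n>0 : n > 0
  n>0 = <-≤-trans (s≤s z≤n) (≤-trans 6≤Q Q≤n)
  n≤z : n ≤ z
  n≤z = m≤m*n n n {{>-nonZero n>0}}
  z>0 : z > 0
  z>0 = <-≤-trans n>0 n≤z
  exponents : 2 * Q + (z + z) < z * Q
  exponents = begin-strict
    2 * Q + (z + z)  ≤⟨ +-monoˡ-≤ (z + z) (*-monoʳ-≤ 2 (≤-trans Q≤n n≤z)) ⟩
    2 * z + (z + z)  ≡⟨ solve 1 (λ z → con 2 :* z :+ (z :+ z) := z :* con 4) refl z ⟩
    z * 4            <⟨ *-monoʳ-< z {{>-nonZero z>0}} (≤ᵇ⇒≤ 5 6 _) ⟩
    z * 6            ≤⟨ *-monoʳ-≤ z 6≤Q ⟩
    z * Q            ∎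

quarter-large : ∀ n m → 20 ≤ n → n ≤ m * 4 + 3 → 4 ≤ m
quarter-large n m 20≤n n≤4m+3 with 4 ≤? m
... | yes 4≤m = 4≤m
... | no  4≰m = ⊥-elim (<⇒≱ (≤-<-trans n≤15 (≤ᵇ⇒≤ 16 20 _)) 20≤n)
  where
  n≤15 : n ≤ 3 * 4 + 3
  n≤15 = ≤-trans n≤4m+3 (+-monoˡ-≤ 3 (*-monoˡ-≤ 4 (≤-pred (≰⇒> 4≰m))))

-- The number of n-tuples is small against (8/7)^(m²) when n ≈ 4m, for Q = 300.
-- (Q is kept abstract so that the large powers are never evaluated.)
tuples-bound : ∀ Q N n m → Q ≡ 300 → N ^ Q ≤ 2 ^ n → Q ≤ n → n ≤ m * 4 + 3 → 2 * (N ^ n * 7 ^ (m * m)) ≤ 8 ^ (m * m)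
tuples-bound Q N n m Q≡300 budget Q≤n n≤4m+3 = ^-cancelʳ-≤ Q {{subst NonZero (sym Q≡300) _}} _ _ (begin
  (2 * (a * 7 ^ k)) ^ Q                  ≡⟨ ^-distrib-* 2 (a * 7 ^ k) Q ⟩
  2 ^ Q * (a * 7 ^ k) ^ Q                ≡⟨ cong (2 ^ Q *_) (^-distrib-* a (7 ^ k) Q) ⟩
  2 ^ Q * (a ^ Q * (7 ^ k) ^ Q)          ≤⟨ *-monoʳ-≤ (2 ^ Q) (*-monoˡ-≤ ((7 ^ k) ^ Q) (tuple-bound N n Q budget)) ⟩
  2 ^ Q * (2 ^ (n * n) * (7 ^ k) ^ Q)    ≡⟨ sym (*-assoc (2 ^ Q) (2 ^ (n * n)) ((7 ^ k) ^ Q)) ⟩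
  (2 ^ Q * 2 ^ (n * n)) * (7 ^ k) ^ Q    ≡⟨ cong₂ _*_ (sym (^-distribˡ-+-* 2 Q (n * n))) (trans (^-*-assoc 7 k Q) (cong (7 ^_) kQ)) ⟩
  2 ^ (Q + n * n) * 7 ^ (6 * j)          ≤⟨ *-monoˡ-≤ (7 ^ (6 * j)) (^-monoʳ-≤ 2 exponents) ⟩
  2 ^ j * 7 ^ (6 * j)                    ≡⟨ cong (2 ^ j *_) (sym (^-*-assoc 7 6 j)) ⟩
  2 ^ j * (7 ^ 6) ^ j                    ≡⟨ sym (^-distrib-* 2 (7 ^ 6) j) ⟩
  (2 * 7 ^ 6) ^ j                        ≤⟨ ^-monoˡ-≤ j (≤ᵇ⇒≤ (2 * 7 ^ 6) (8 ^ 6) _) ⟩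
  (8 ^ 6) ^ j                            ≡⟨ ^-*-assoc 8 6 j ⟩
  8 ^ (6 * j)                            ≡⟨ cong (8 ^_) (sym kQ) ⟩
  8 ^ (k * Q)                            ≡⟨ sym (^-*-assoc 8 k Q) ⟩
  (8 ^ k) ^ Q                            ∎)
  where
  open ≤-Reasoning
  a = N ^ n
  k = m * m
  j = k * 50
  kQ : k * Q ≡ 6 * j
  kQ = trans (cong (k *_) Q≡300) (solve 1 (λ k → k :* con 300 := con 6 :* (k :* con 50)) refl k)
  4≤m : 4 ≤ m
  4≤m = quarter-large n m (≤-trans (≤ᵇ⇒≤ 20 300 _) (subst (_≤ n) Q≡300 Q≤n)) n≤4m+3
  n≤5m : n ≤ m * 5
  n≤5m = ≤-trans n≤4m+3 (≤-trans (+-monoʳ-≤ (m * 4) (≤-trans (≤ᵇ⇒≤ 3 4 _) 4≤m))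
           (≤-reflexive (solve 1 (λ m → m :* con 4 :+ m := m :* con 5) refl m)))
  exponents : Q + n * n ≤ j
  exponents = begin
    Q + n * n                 ≤⟨ +-mono-≤ (≤-reflexive Q≡300) (*-mono-≤ n≤5m n≤5m) ⟩
    300 + (m * 5) * (m * 5)
      ≤⟨ +-monoˡ-≤ ((m * 5) * (m * 5)) (≤-trans (≤ᵇ⇒≤ 300 (25 * 16) _) (*-monoʳ-≤ 25 (*-mono-≤ 4≤m 4≤m))) ⟩
    25 * k + (m * 5) * (m * 5) ≡⟨ solve 1 (λ m → con 25 :* (m :* m) :+ (m :* con 5) :* (m :* con 5) := m :* m :* con 50) refl m ⟩
    j                         ∎

budget-exponent : ∀ Q N n → 2 ≤ N → N ^ Q ≤ 2 ^ n → Q ≤ n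
budget-exponent Q N n 2≤N budget with Q ≤? n
... | yes Q≤n = Q≤n
... | no  Q≰n = ⊥-elim (<⇒≱ (^-monoʳ-< 2 (s≤s (s≤s z≤n)) (≰⇒> Q≰n)) (≤-trans (^-monoˡ-≤ Q 2≤N) budget))

quarter-below : ∀ n → n / 4 + n / 4 + (n / 4 + n / 4) ≤ n
quarter-below n = subst (_≤ n) (solve 1 (λ m → m :* con 4 := m :+ m :+ (m :+ m)) refl (n / 4)) (m/n*n≤m n 4)

quarter-above : ∀ n → n ≤ n / 4 * 4 + 3
quarter-above n = begin
  n                  ≡⟨ m≡m%n+[m/n]*n n 4 ⟩
  n % 4 + n / 4 * 4  ≤⟨ +-monoˡ-≤ (n / 4 * 4) (≤-pred (m%n<n n 4)) ⟩
  3 + n / 4 * 4      ≡⟨ +-comm 3 (n / 4 * 4) ⟩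
  n / 4 * 4 + 3      ∎
  where open ≤-Reasoning

below-half : ∀ b W X P → 0 < P → b * W ≤ X * P → 2 * X < W → 2 * b < P
below-half b W X P P>0 bW≤XP 2X<W = *-cancelʳ-< W (2 * b) P (begin-strict
  2 * b * W    ≡⟨ *-assoc 2 b W ⟩
  2 * (b * W)  ≤⟨ *-monoʳ-≤ 2 bW≤XP ⟩
  2 * (X * P)  ≡⟨ sym (*-assoc 2 X P) ⟩
  2 * X * P    <⟨ *-monoˡ-< P {{>-nonZero P>0}} 2X<W ⟩
  W * P        ≡⟨ *-comm W P ⟩
  P * W        ∎)
  where open ≤-Reasoning

at-most-half : ∀ b W X P → 0 < W → b * W ≤ X * P → 2 * X ≤ W → 2 * b ≤ P
at-most-half b W X P W>0 bW≤XP 2X≤W = *-cancelʳ-≤ (2 * b) P W {{>-nonZero W>0}} (begin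
  2 * b * W    ≡⟨ *-assoc 2 b W ⟩
  2 * (b * W)  ≤⟨ *-monoʳ-≤ 2 bW≤XP ⟩
  2 * (X * P)  ≡⟨ sym (*-assoc 2 X P) ⟩
  2 * X * P    ≤⟨ *-monoˡ-≤ P 2X≤W ⟩
  W * P        ≡⟨ *-comm W P ⟩
  P * W        ∎)
  where open ≤-Reasoning

NoMonochromaticPair : (N n : ℕ) → Colouring N → Set
NoMonochromaticPair N n φ = ¬ (Σ (Subset N) λ A → Σ (Subset N) λ B →
  ∣ A ∣ ≡ n × ∣ B ∣ ≡ n × (∀ x → x ∈ A → x ∉ B) ×
  ((∀ a b → a ∈ A → b ∈ B → col φ a b ≡ red) ⊎ (∀ a b → a ∈ A → b ∈ B → col φ a b ≡ blue)))

EverySetHasPattern : (N n : ℕ) → Colouring N → Set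
EverySetHasPattern N n φ = ∀ (A : Subset N) → ∣ A ∣ ≡ n →
  Σ (Fin N) λ i → Σ (Fin N) λ j → Σ (Fin N) λ k →
  i ∈ A × j ∈ A × k ∈ A × i F.< j × j F.< k × col φ i j ≡ blue × col φ j k ≡ blue × col φ i k ≡ red

Good : ℕ → ℕ → Set
Good N n = Σ (Colouring N) λ φ → NoMonochromaticPair N n φ × EverySetHasPattern N n φ

good-when-small : ∀ N n → N < n → Good N n
good-when-small N n N<n = record { col = λ _ _ → red ; symm = λ _ _ → refl } ,
  (λ (A , _ , |A|≡n , _) → too-big A |A|≡n) , (λ A |A|≡n → ⊥-elim (too-big A |A|≡n))
  where
  too-big : ∀ (A : Subset N) → ∣ A ∣ ≡ n → ⊥
  too-big A |A|≡n = <-irrefl refl (≤-<-trans (subst (_≤ N) |A|≡n (∣p∣≤n A)) N<n)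

module RandomColouring (N n′ m : ℕ) (4m≤n : m + m + (m + m) ≤ suc n′) where

  n : ℕ
  n = suc n′

  P : ℕ
  P = 2 ^ (N * N)

  monochromaticPair : Vec Bool (N * N) → Bool
  monochromaticPair = anyTuple N n λ a → anyTuple N n λ b → Bipartite.event a b

  patternFreeTuple : Vec Bool (N * N) → Bool
  patternFreeTuple = anyTuple N n (Triangles.event m 4m≤n)

  count-monochromaticPair : count monochromaticPair * 2 ^ (n * n) ≤ 2 * (N ^ n * N ^ n) * P
  count-monochromaticPair = subst (count monochromaticPair * 2 ^ (n * n) ≤_)
    (solve 3 (λ x y P → x :* (y :* (con 2 :* P)) := con 2 :* (x :* y) :* P) refl (N ^ n) (N ^ n) P)
    (count-anyTuple N n (λ a → anyTuple N n (Bipartite.event a)) (2 ^ (n * n)) (N ^ n * (2 * P)) λ a →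
     count-anyTuple N n (Bipartite.event a) (2 ^ (n * n)) (2 * P) (Bipartite.count-event a))

  count-patternFreeTuple : count patternFreeTuple * 8 ^ (m * m) ≤ N ^ n * 7 ^ (m * m) * P
  count-patternFreeTuple = subst (count patternFreeTuple * 8 ^ (m * m) ≤_) (sym (*-assoc (N ^ n) _ P))
    (count-anyTuple N n (Triangles.event m 4m≤n) (8 ^ (m * m)) (7 ^ (m * m) * P) (Triangles.count-event m 4m≤n))

  no-monochromatic-pair : ∀ v → monochromaticPair v ≡ false → NoMonochromaticPair N n (colouring v)
  no-monochromatic-pair v none (A , B , |A|≡n , |B|≡n , A∩B≡∅ , mono) = true≢false (trans (sym occurs) fails)
    where
    a = listing-of-size A |A|≡n
    b = listing-of-size B |B|≡n
    fails : Bipartite.event (proj₁ a) (proj₁ b) v ≡ false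
    fails = anyTuple-false N n (Bipartite.event (proj₁ a)) v
      (anyTuple-false N n (λ a → anyTuple N n (Bipartite.event a)) v none (proj₁ a)) (proj₁ b)
    apart : Bipartite.Apart (proj₁ a) (proj₁ b)
    apart i j e = A∩B≡∅ _ (proj₂ (proj₂ a) i) (subst (_∈ B) (sym e) (proj₂ (proj₂ b) j))
    occurs : Bipartite.event (proj₁ a) (proj₁ b) v ≡ true
    occurs = Bipartite.event-intro (proj₁ a) (proj₁ b) v (proj₁ (proj₂ a)) (proj₁ (proj₂ b)) apart
      ([ (λ all-red  → red  , λ i j → all-red  _ _ (proj₂ (proj₂ a) i) (proj₂ (proj₂ b) j))
       , (λ all-blue → blue , λ i j → all-blue _ _ (proj₂ (proj₂ a) i) (proj₂ (proj₂ b) j)) ]′ mono)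

  every-set-has-pattern : ∀ v → patternFreeTuple v ≡ false → EverySetHasPattern N n (colouring v)
  every-set-has-pattern v none A |A|≡n =
    s (corner₁ τ) , s (corner₂ τ) , s (corner₃ τ) ,
    member (corner₁ τ) c₁<n , member (corner₂ τ) c₂<n , member (corner₃ τ) c₃<n ,
    s-increasing inc _ _ (corner₁<corner₂ τ valid) c₂<n , s-increasing inc _ _ (corner₂<corner₃ τ valid) c₃<n ,
    blue₁₂ , blue₂₃ , red₁₃
    where
    listed = listing-of-size A |A|≡n
    t = proj₁ listed
    inc = proj₁ (proj₂ listed)
    open Triangles m 4m≤n t
    found = pattern-found v inc (anyTuple-false N n (Triangles.event m 4m≤n) v none t)
    τ = proj₁ found
    valid = proj₁ (proj₂ found)
    blue₁₂ = proj₁ (proj₂ (proj₂ found))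
    blue₂₃ = proj₁ (proj₂ (proj₂ (proj₂ found)))
    red₁₃ = proj₂ (proj₂ (proj₂ (proj₂ found)))
    c₃<n = <-≤-trans (corner₃<4m τ valid) 4m≤n
    c₂<n = <-trans (corner₂<corner₃ τ valid) c₃<n
    c₁<n = <-trans (corner₁<corner₂ τ valid) c₂<n
    member : ∀ I → I < n → s I ∈ A
    member I I<n = subst (_∈ A) (sym (at-lookup _ t I I<n)) (proj₂ (proj₂ listed) (F.fromℕ< I<n))

  good-colouring : 2 * (2 * (N ^ n * N ^ n)) < 2 ^ (n * n) → 2 * (N ^ n * 7 ^ (m * m)) ≤ 8 ^ (m * m) → Good N n
  good-colouring pairs-rare tuples-rare =
    colouring v , no-monochromatic-pair v (∨-falseˡ _ bad≡false) , every-set-has-pattern v (∨-falseʳ _ bad≡false)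
    where
    bad : Vec Bool (N * N) → Bool
    bad v = monochromaticPair v ∨ patternFreeTuple v
    monochromatic-rare : 2 * count monochromaticPair < P
    monochromatic-rare = below-half (count monochromaticPair) (2 ^ (n * n)) (2 * (N ^ n * N ^ n)) P
      (m^n>0 2 (N * N)) count-monochromaticPair pairs-rare
    pattern-free-rare : 2 * count patternFreeTuple ≤ P
    pattern-free-rare = at-most-half (count patternFreeTuple) (8 ^ (m * m)) (N ^ n * 7 ^ (m * m)) P
      (m^n>0 8 (m * m)) count-patternFreeTuple tuples-rare
    rare : count bad < P
    rare = ≤-<-trans (count-∨ monochromaticPair patternFreeTuple) (*-cancelˡ-< 2 _ _ (begin-strict
      2 * (count monochromaticPair + count patternFreeTuple)
        ≡⟨ *-distribˡ-+ 2 (count monochromaticPair) _ ⟩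
      2 * count monochromaticPair + 2 * count patternFreeTuple
        <⟨ +-mono-<-≤ monochromatic-rare pattern-free-rare ⟩
      P + P
        ≡⟨ cong (P +_) (sym (+-identityʳ P)) ⟩
      2 * P ∎))
      where open ≤-Reasoning
    v = proj₁ (avoid bad rare)
    bad≡false = proj₂ (avoid bad rare)

good-colouring-exists : ∀ Q → Q ≡ 300 → ∀ n N → N ^ Q ≤ 2 ^ n → 6 ≤ n → Good N n
good-colouring-exists Q Q≡300 zero      N budget ()
good-colouring-exists Q Q≡300 n@(suc n′) N budget 6≤n with n ≤? N
... | no  n≰N = good-when-small N n (≰⇒> n≰N)
... | yes n≤N = RandomColouring.good-colouring N n′ (n / 4) (quarter-below n)
  (pairs-bound Q N n 6≤Q budget Q≤n) (tuples-bound Q N n (n / 4) Q≡300 budget Q≤n (quarter-above n))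
  where
  6≤Q : 6 ≤ Q
  6≤Q = subst (6 ≤_) (sym Q≡300) (≤ᵇ⇒≤ 6 300 _)
  Q≤n : Q ≤ n
  Q≤n = budget-exponent Q N n (≤-trans (s≤s (s≤s z≤n)) (≤-trans 6≤n n≤N)) budget

rootSearch-bound : ∀ q x b → rootSearch (suc q) x b ^ suc q ≤ x
rootSearch-bound q x zero    = z≤n
rootSearch-bound q x (suc b) with (suc b ^ suc q) ≤ᵇ x in fits
... | true  = ≤ᵇ⇒≤ _ _ (subst T (sym fits) _)
... | false = rootSearch-bound q x b

lemma3p1 : Σ ℕ λ p → Σ ℕ λ q →
    ∀ n → n ≥ 6 →
      Σ (Colouring (floor2^ (suc p) (suc q) n)) λ φ →
        (¬ (Σ (Subset (floor2^ (suc p) (suc q) n)) λ A → Σ (Subset (floor2^ (suc p) (suc q) n)) λ B →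
              ∣ A ∣ ≡ n × ∣ B ∣ ≡ n × (∀ x → x ∈ A → x ∉ B) ×
              ((∀ a b → a ∈ A → b ∈ B → col φ a b ≡ red) ⊎ (∀ a b → a ∈ A → b ∈ B → col φ a b ≡ blue))))
        × (∀ (A : Subset (floor2^ (suc p) (suc q) n)) → ∣ A ∣ ≡ n →
             Σ (Fin (floor2^ (suc p) (suc q) n)) λ i → Σ (Fin (floor2^ (suc p) (suc q) n)) λ j → Σ (Fin (floor2^ (suc p) (suc q) n)) λ k →
               i ∈ A × j ∈ A × k ∈ A × i F.< j × j F.< k ×
               col φ i j ≡ blue × col φ j k ≡ blue × col φ i k ≡ red)
lemma3p1 = 0 , 299 , λ n 6≤n → good-colouring-exists 300 refl n (floor2^ 1 300 n) (budget n) 6≤n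
  where
  budget : ∀ n → floor2^ 1 300 n ^ 300 ≤ 2 ^ n
  budget n = subst (floor2^ 1 300 n ^ 300 ≤_) (cong (2 ^_) (*-identityˡ n)) (rootSearch-bound 299 (2 ^ (1 * n)) (2 ^ (1 * n)))
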